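{- Let $\mathcal{G}$ and $\mathcal{H}$ be two hypergraphs on vertex set $V$, and let $\sigma=\langle\mathrm{In},\mathrm{Ex}\rangle$ be an assignment. (a) If $T$ is a transversal of $\mathcal{G}$ coherent with $\sigma$, then $T'=T\setminus\mathrm{In}$ is a transversal of $\mathcal{G}(\sigma)$. (b) If $T$ is an independent set of $\mathcal{H}$ coherent with $\sigma$, then $T'=T\setminus\mathrm{In}$ is an independent set of $\mathcal{H}(\sigma)$. Hence, if $T$ is a new transversal of $\mathcal{G}$ with respect to $\mathcal{H}$ coherent with $\sigma$, then $T\setminus\mathrm{In}$ is a new transversal of $\mathcal{G}(\sigma)$ with respect to $\mathcal{H}(\sigma)$.
   Context: Hypergraphs are identified with their edge sets. Transversal: meets every edge (every set is a transversal of the empty hypergraph; none is of $\{\emptyset\}$); independent set: contains no edge; new transversal of $\mathcal{G}$ w.r.t. $\mathcal{H}$: transversal of $\mathcal{G}$ that is independent in $\mathcal{H}$. An assignment is a pair $\langle\mathrm{In},\mathrm{Ex}\rangle$ of disjoint subsets of $V$, coherent with $T$ if $\mathrm{In}\subseteq T$ and $\mathrm{Ex}\cap T=\emptyset$. For $S\subseteq V$: $\mathcal{G}_S=\{G\in\mathcal{G}:G\subseteq S\}$, $\mathcal{G}^S=\min(\{G\cap S:G\in\mathcal{G}\})$ ($\min$ keeps inclusion-minimal sets). $\mathcal{G}(\sigma)=(\mathcal{G}_{V\setminus\mathrm{In}})^{V\setminus(\mathrm{In}\cup\mathrm{Ex})}$, $\mathcal{H}(\sigma)=(\mathcal{H}_{V\setminus\mathrm{Ex}})^{V\setminus(\mathrm{In}\cup\mathrm{Ex})}$.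 -}

module Defs where

open import Data.Nat using (ℕ)
open import Data.Fin using (Fin)
open import Data.Fin.Subset using (Subset; _∈_; _∉_; _⊆_; _∩_; _∪_; ∁; _─_)
open import Data.Product using (Σ; _×_; ∃-syntax)
open import Relation.Nullary using (¬_)
open import Relation.Binary.PropositionalEquality using (_≡_)

-- A hypergraph on vertex set V = Fin n is identified with its edge set,
-- given as a predicate on subsets of V (V finite, so the edge set is finite).
Hypergraph : ℕ → Set₁
Hypergraph n = Subset n → Set

Transversal : {n : ℕ} → Hypergraph n → Subset n → Set
Transversal H T = ∀ E → H E → ∃[ x ] (x ∈ E × x ∈ T)

Independent : {n : ℕ} → Hypergraph n → Subset n → Set
Independent H T = ∀ E → H E → ¬ (E ⊆ T)

NewTransversal : {n : ℕ} → Hypergraph n → Hypergraph n → Subset n → Set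
NewTransversal G H T = Transversal G T × Independent H T

minimal : {n : ℕ} → Hypergraph n → Hypergraph n
minimal F X = F X × (∀ Y → F Y → Y ⊆ X → Y ≡ X)

restrict : {n : ℕ} → Hypergraph n → Subset n → Hypergraph n
restrict G S E = G E × E ⊆ S

trace : {n : ℕ} → Hypergraph n → Subset n → Hypergraph n
trace G S = minimal (λ X → ∃[ E ] (G E × X ≡ E ∩ S))

record Assignment (n : ℕ) : Set where
  constructor ⟨_,_⟩[_]
  field
    In       : Subset n
    Ex       : Subset n
    disjoint : ∀ x → x ∈ In → x ∉ Ex
open Assignment public

Coherent : {n : ℕ} → Assignment n → Subset n → Set
Coherent σ T = In σ ⊆ T × (∀ x → x ∈ Ex σ → x ∉ T)

G[_] : {n : ℕ} → Assignment n → Hypergraph n → Hypergraph n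
G[ σ ] G = trace (restrict G (∁ (In σ))) (∁ (In σ ∪ Ex σ))

H[_] : {n : ℕ} → Assignment n → Hypergraph n → Hypergraph n
H[ σ ] H = trace (restrict H (∁ (Ex σ))) (∁ (In σ ∪ Ex σ))

module Submission where

open import Defs
open import Data.Nat using (ℕ)
open import Data.Fin using (Fin)
open import Data.Fin.Subset using (Subset; _∈_; _∉_; _⊆_; _∪_; ∁; _─_; inside; outside)
open import Data.Fin.Subset.Properties
  using (_∈?_; x∈p∩q⁺; x∈p∪q⁻; x∉p⇒x∈∁p; x∈∁p⇒x∉p; x∉∁p⇒x∈p; x∈p∧x∉q⇒x∈p─q; p─q⊆p)
open import Data.Product using (_×_; _,_)
open import Data.Sum using ([_,_]; inj₁; inj₂)
open import Data.Vec using (_∷_; here; there)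
open import Function using (_∘_)
open import Relation.Nullary using (yes; no; contradiction)
open import Relation.Binary.PropositionalEquality using (subst; sym)

private
  variable
    n : ℕ
    x : Fin n
    S T U : Subset n
    G H : Hypergraph n

x∈p─q⇒x∉q : ∀ (p q : Subset n) → x ∈ p ─ q → x ∉ q
x∈p─q⇒x∉q (inside ∷ p) (outside ∷ q) here        ()
x∈p─q⇒x∉q (_      ∷ p) (_       ∷ q) (there x∈) (there x∈q) = x∈p─q⇒x∉q p q x∈ x∈q

x∉p∪q : ∀ (p q : Subset n) → x ∉ p → x ∉ q → x ∉ p ∪ q
x∉p∪q p q x∉p x∉q = [ x∉p , x∉q ] ∘ x∈p∪q⁻ p q

p─q⊆∁[q∪r] : ∀ (p q r : Subset n) → (∀ x → x ∈ r → x ∉ p) → p ─ q ⊆ ∁ (q ∪ r)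
p─q⊆∁[q∪r] p q r r∩p≡∅ {x} x∈p─q =
  x∉p⇒x∈∁p (x∉p∪q q r (x∈p─q⇒x∉q p q x∈p─q) (λ x∈r → r∩p≡∅ x x∈r (p─q⊆p p q x∈p─q)))

p⊆∁r⇒p─∁[q∪r]⊆q : ∀ (p q r : Subset n) → p ⊆ ∁ r → p ─ ∁ (q ∪ r) ⊆ q
p⊆∁r⇒p─∁[q∪r]⊆q p q r p⊆∁r x∈ with x∈p∪q⁻ q r (x∉∁p⇒x∈p (x∈p─q⇒x∉q p _ x∈))
... | inj₁ x∈q = x∈q
... | inj₂ x∈r = contradiction x∈r (x∈∁p⇒x∉p (p⊆∁r (p─q⊆p p _ x∈)))

transversal-restrict-─ : ∀ (p : Subset n) → Transversal G T → Transversal (restrict G (∁ p)) (T ─ p)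
transversal-restrict-─ p tr E (gE , E⊆∁p) with tr E gE
... | x , x∈E , x∈T = x , x∈E , x∈p∧x∉q⇒x∈p─q x∈T (x∈∁p⇒x∉p (E⊆∁p x∈E))

transversal-trace : Transversal G T → T ⊆ S → Transversal (trace G S) T
transversal-trace tr T⊆S X ((E , gE , X≡E∩S) , _) with tr E gE
... | x , x∈E , x∈T = x , subst (x ∈_) (sym X≡E∩S) (x∈p∩q⁺ (x∈E , T⊆S x∈T)) , x∈T

independent-restrict : Independent H T → Independent (restrict H S) T
independent-restrict ind E (hE , _) = ind E hE

independent-trace : Independent H T → (∀ E → H E → E ─ S ⊆ T) → Independent (trace H S) T
independent-trace {T = T} {S = S} ind E─S⊆T X ((E , hE , X≡E∩S) , _) X⊆T = ind E hE E⊆T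
  where
  E⊆T : E ⊆ T
  E⊆T {x} x∈E with x ∈? S
  ... | yes x∈S = X⊆T (subst (x ∈_) (sym X≡E∩S) (x∈p∩q⁺ (x∈E , x∈S)))
  ... | no  x∉S = E─S⊆T E hE (x∈p∧x∉q⇒x∈p─q x∈E x∉S)

independent-anti-mono : U ⊆ T → Independent H T → Independent H U
independent-anti-mono U⊆T ind E hE E⊆U = ind E hE (U⊆T ∘ E⊆U)

lemma23 : {n : ℕ} (G H : Hypergraph n) (σ : Assignment n)
    → ((T : Subset n) → Transversal G T → Coherent σ T
         → Transversal (G[ σ ] G) (T ─ In σ))
    × ((T : Subset n) → Independent H T → Coherent σ T
         → Independent (H[ σ ] H) (T ─ In σ))
    × ((T : Subset n) → NewTransversal G H T → Coherent σ T
         → NewTransversal (G[ σ ] G) (H[ σ ] H) (T ─ In σ))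
lemma23 G H σ = transversal , independent , λ T (tr , ind) coh → transversal T tr coh , independent T ind coh
  where
  transversal : (T : Subset _) → Transversal G T → Coherent σ T → Transversal (G[ σ ] G) (T ─ In σ)
  transversal T tr (_ , Ex∩T≡∅) =
    transversal-trace (transversal-restrict-─ (In σ) tr) (p─q⊆∁[q∪r] T (In σ) (Ex σ) Ex∩T≡∅)

  independent : (T : Subset _) → Independent H T → Coherent σ T → Independent (H[ σ ] H) (T ─ In σ)
  independent T ind (In⊆T , _) =
    independent-anti-mono (p─q⊆p T (In σ))
      (independent-trace (independent-restrict ind)
        (λ E (_ , E⊆∁Ex) → In⊆T ∘ p⊆∁r⇒p─∁[q∪r]⊆q E (In σ) (Ex σ) E⊆∁Ex))
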